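{- Let $F$ be an admissible sequence and $1\le k\le n$, with $m=n-k+1$. Let $G$ be the graph whose vertices are all sub-boxes of $V_{m,n}$ of the form $\sigma V_m$, two being adjacent iff disjoint. If $G$ has a clique $\chi$ of size $d=\binom{n}{m}_F$, then $\chi$ is a maximal clique of $G$.
   Context: Notation: $n_F!=n_F\cdots1_F$, $0_F!=1$, $\binom{n}{m}_F=\frac{n_F!}{m_F!(n-m)_F!}$. $F$ is admissible if these values are in $\mathbb{N}\cup\{0\}$ for all $n\ge m\ge0$. Write $[s_F]=\{1,\dots,s_F\}$, and let $V_{m,n}=[k_F]\times\cdots\times[n_F]$. A sub-box of the form $\sigma V_m$ is $A_1\times\cdots\times A_m$ with $A_s\subseteq[(k+s-1)_F]$ and $|A_s|=(\sigma(s))_F$, where $\sigma$ is a permutation of $\{1,\dots,m\}$. -}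

module Defs where

open import Data.Nat using (ℕ; zero; suc; _+_; _*_; _∸_; _≤_)
open import Data.Fin using (Fin; toℕ)
open import Data.Fin.Subset using (Subset; _∈_; ∣_∣)
open import Data.Fin.Permutation using (Permutation′; _⟨$⟩ʳ_)
open import Data.Product using (Σ; ∃; _×_)
open import Data.List using (List)
open import Data.List.Relation.Unary.All using (All)
open import Data.List.Relation.Unary.Any using (Any)
open import Data.List.Relation.Unary.AllPairs using (AllPairs)
open import Relation.Nullary using (¬_)
open import Relation.Binary.PropositionalEquality using (_≡_)

_F! : (ℕ → ℕ) → ℕ → ℕ
(F F!) zero = 1
(F F!) (suc n) = F (suc n) * (F F!) n

-- Admissible: every F-nomial n_F!/(m_F!(n-m)_F!) is a well-defined
-- element of ℕ ∪ {0} (denominators non-zero, division exact).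
Admissible : (ℕ → ℕ) → Set
Admissible F =
  ((i : ℕ) → ¬ (F (suc i) ≡ 0)) ×
  ((n m : ℕ) → m ≤ n → ∃ λ b → b * ((F F!) m * (F F!) (n ∸ m)) ≡ (F F!) n)

-- A box inside V_{m,n} = [k_F] × ... × [n_F] (m = n - k + 1 coordinates);
-- coordinate s (0-based) ranges over [(k+s)_F], represented by Fin (F (k+s)).
Box : (ℕ → ℕ) → ℕ → ℕ → Set
Box F k m = (s : Fin m) → Subset (F (k + toℕ s))

Point : (ℕ → ℕ) → ℕ → ℕ → Set
Point F k m = (s : Fin m) → Fin (F (k + toℕ s))

InBox : (F : ℕ → ℕ) (k m : ℕ) → Point F k m → Box F k m → Set
InBox F k m x A = ∀ s → x s ∈ A s

-- A sub-box of the form σ V_m: |A_s| = (σ(s))_F for a permutation σ of {1..m}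
-- (with 0-based s, σ(s) is 1 + toℕ (σ ⟨$⟩ʳ s)).
IsSigmaBox : (F : ℕ → ℕ) (k m : ℕ) → Box F k m → Set
IsSigmaBox F k m A =
  Σ (Permutation′ m) λ σ → ∀ s → ∣ A s ∣ ≡ F (suc (toℕ (σ ⟨$⟩ʳ s)))

Disjoint : (F : ℕ → ℕ) (k m : ℕ) → Box F k m → Box F k m → Set
Disjoint F k m A B = ¬ (Σ (Point F k m) λ x → InBox F k m x A × InBox F k m x B)

-- Equality of boxes as sets (boxes are nonempty, so componentwise equality)
SameBox : (F : ℕ → ℕ) (k m : ℕ) → Box F k m → Box F k m → Set
SameBox F k m A B = ∀ s → A s ≡ B s

-- A clique of G: list of vertices, pairwise adjacent (hence pairwise distinct)
IsClique : (F : ℕ → ℕ) (k m : ℕ) → List (Box F k m) → Set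
IsClique F k m χ = All (IsSigmaBox F k m) χ × AllPairs (Disjoint F k m) χ

IsMaximalClique : (F : ℕ → ℕ) (k m : ℕ) → List (Box F k m) → Set
IsMaximalClique F k m χ =
  IsClique F k m χ ×
  ((B : Box F k m) → IsSigmaBox F k m B → All (Disjoint F k m B) χ → Any (SameBox F k m B) χ)

-- Every σ-box has the same volume |V_m| = m_F!, while V_{m,n} has
-- volume n_F! / (k-1)_F! = d m_F!.  Hence d pairwise disjoint σ-boxes
-- fill V_{m,n} completely: counting, for each point, how many boxes of χ
-- contain it gives a function bounded by 1 whose total is the number of
-- points, so it is identically 1.  A σ-box is nonempty, so it meets a
-- box of χ and cannot be adjacent to all of χ.

module Submission where

open import Defs
open import Data.Nat using (ℕ; zero; suc; _+_; _*_; _∸_; _≤_; z≤n; s≤s; ≢-nonZero)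
open import Data.Nat.Properties
open import Data.Nat.ListAction using (sum)
open import Data.Bool using (Bool; true; false)
open import Data.Fin using (Fin; toℕ) renaming (zero to fzero; suc to fsuc)
open import Data.Fin.Subset using (Subset; ⊤; Nonempty; ∣_∣) renaming (_∈_ to _∈ₛ_)
open import Data.Fin.Subset.Properties using (∈⊤; nonempty?; Empty-unique; ∣⊥∣≡0; ∣⊤∣≡n)
open import Data.Fin.Permutation using (_⟨$⟩ʳ_)
open import Data.Vec as Vec using (lookup)
open import Data.Vec.Properties using ([]=⇒lookup; lookup⇒[]=)
open import Data.List using (List; []; _∷_; length; map)
open import Data.List.Relation.Unary.All as All using (All; []; _∷_)
open import Data.List.Relation.Unary.All.Properties using (All¬⇒¬Any)
open import Data.List.Relation.Unary.Any using (Any; here; there)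
open import Data.List.Relation.Unary.AllPairs using (AllPairs; []; _∷_)
open import Data.Product using (Σ; ∃; _×_; _,_; proj₁; proj₂)
open import Data.Sum using (_⊎_; inj₁; inj₂)
open import Function using (_∘_)
open import Relation.Nullary using (¬_; yes; no; contradiction)
open import Relation.Binary.Core using (_Preserves_⟶_)
open import Relation.Binary.PropositionalEquality
  using (_≡_; _≢_; refl; sym; trans; cong; cong₂; module ≡-Reasoning)
open import Algebra.Properties.Semiring.Sum +-*-semiring
  using (sum-syntax; sum-cong-≗; sum-replicate-zero; ∑-distrib-+; *-distribˡ-sum; *-distribʳ-sum)
open import Algebra.Properties.CommutativeMonoid.Sum *-1-commutativeMonoid
  using () renaming (sum to prod; sum-cong-≗ to prod-cong-≗; sum-replicate-zero to prod-replicate-one;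
                     ∑-permute to prod-permute)

+-mono-≤-≡⇒≡ : ∀ {a b c d} → a ≤ b → c ≤ d → a + c ≡ b + d → a ≡ b × c ≡ d
+-mono-≤-≡⇒≡ {a} {b} {c} {d} a≤b c≤d eq = a≡b , +-cancelˡ-≡ a c d (trans eq (cong (_+ d) (sym a≡b)))
  where
  b≤a : b ≤ a
  b≤a = +-cancelʳ-≤ d b a (≤-trans (≤-reflexive (sym eq)) (+-monoʳ-≤ a c≤d))
  a≡b : a ≡ b
  a≡b = ≤-antisym a≤b b≤a

∑-mono-≤ : ∀ {n} {f h : Fin n → ℕ} → (∀ i → f i ≤ h i) → ∑[ i < n ] f i ≤ ∑[ i < n ] h i
∑-mono-≤ {zero}  f≤h = z≤n
∑-mono-≤ {suc n} f≤h = +-mono-≤ (f≤h fzero) (∑-mono-≤ (f≤h ∘ fsuc))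

∑-mono-≤-≡⇒≡ : ∀ {n} {f h : Fin n → ℕ} → (∀ i → f i ≤ h i) →
               ∑[ i < n ] f i ≡ ∑[ i < n ] h i → ∀ i → f i ≡ h i
∑-mono-≤-≡⇒≡ {suc n} f≤h eq fzero =
  proj₁ (+-mono-≤-≡⇒≡ (f≤h fzero) (∑-mono-≤ (f≤h ∘ fsuc)) eq)
∑-mono-≤-≡⇒≡ {suc n} f≤h eq (fsuc i) =
  ∑-mono-≤-≡⇒≡ (f≤h ∘ fsuc) (proj₂ (+-mono-≤-≡⇒≡ (f≤h fzero) (∑-mono-≤ (f≤h ∘ fsuc)) eq)) i

Pt : ∀ {m} → (Fin m → ℕ) → Set
Pt {m} g = (s : Fin m) → Fin (g s)

_≈ₚ_ : ∀ {m} {g : Fin m → ℕ} → Pt g → Pt g → Set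
x ≈ₚ y = ∀ s → x s ≡ y s

_◃_ : ∀ {m} {g : Fin (suc m) → ℕ} → Fin (g fzero) → Pt (g ∘ fsuc) → Pt g
(i ◃ x) fzero    = i
(i ◃ x) (fsuc s) = x s

∑ₚ : ∀ {m} (g : Fin m → ℕ) → (Pt g → ℕ) → ℕ
∑ₚ {zero}  g f = f (λ ())
∑ₚ {suc m} g f = ∑[ i < g fzero ] ∑ₚ (g ∘ fsuc) (λ x → f (i ◃ x))

∑ₚ-zero : ∀ {m} (g : Fin m → ℕ) → ∑ₚ g (λ _ → 0) ≡ 0
∑ₚ-zero {zero}  g = refl
∑ₚ-zero {suc m} g = trans (sum-cong-≗ {g fzero} (λ _ → ∑ₚ-zero (g ∘ fsuc))) (sum-replicate-zero (g fzero))

∑ₚ-distrib-+ : ∀ {m} (g : Fin m → ℕ) (f h : Pt g → ℕ) →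
               ∑ₚ g (λ x → f x + h x) ≡ ∑ₚ g f + ∑ₚ g h
∑ₚ-distrib-+ {zero}  g f h = refl
∑ₚ-distrib-+ {suc m} g f h =
  trans (sum-cong-≗ {g fzero} (λ i → ∑ₚ-distrib-+ (g ∘ fsuc) (f ∘ (i ◃_)) (h ∘ (i ◃_))))
        (∑-distrib-+ (λ i → ∑ₚ (g ∘ fsuc) (f ∘ (i ◃_))) (λ i → ∑ₚ (g ∘ fsuc) (h ∘ (i ◃_))))

∑ₚ-*ˡ : ∀ {m} (g : Fin m → ℕ) c (f : Pt g → ℕ) → ∑ₚ g (λ x → c * f x) ≡ c * ∑ₚ g f
∑ₚ-*ˡ {zero}  g c f = refl
∑ₚ-*ˡ {suc m} g c f =
  trans (sum-cong-≗ {g fzero} (λ i → ∑ₚ-*ˡ (g ∘ fsuc) c (f ∘ (i ◃_))))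
        (sym (*-distribˡ-sum c (λ i → ∑ₚ (g ∘ fsuc) (f ∘ (i ◃_)))))

∑ₚ-mono-≤ : ∀ {m} (g : Fin m → ℕ) {f h : Pt g → ℕ} → (∀ x → f x ≤ h x) → ∑ₚ g f ≤ ∑ₚ g h
∑ₚ-mono-≤ {zero}  g f≤h = f≤h _
∑ₚ-mono-≤ {suc m} g f≤h = ∑-mono-≤ (λ i → ∑ₚ-mono-≤ (g ∘ fsuc) (λ x → f≤h (i ◃ x)))

-- Points are functions, so without extensionality x and x 0 ◃ (x ∘ suc)
-- are only pointwise equal; hence the hypotheses that f and h respect ≈ₚ.
∑ₚ-mono-≤-≡⇒≡ : ∀ {m} (g : Fin m → ℕ) {f h : Pt g → ℕ} →
                f Preserves _≈ₚ_ ⟶ _≡_ → h Preserves _≈ₚ_ ⟶ _≡_ →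
                (∀ x → f x ≤ h x) → ∑ₚ g f ≡ ∑ₚ g h → ∀ x → f x ≡ h x
∑ₚ-mono-≤-≡⇒≡ {zero} g f-resp h-resp f≤h eq x = trans (f-resp (λ ())) (trans eq (h-resp (λ ())))
∑ₚ-mono-≤-≡⇒≡ {suc m} g {f} {h} f-resp h-resp f≤h eq x =
  trans (f-resp x≈) (trans (on-slice (x ∘ fsuc)) (h-resp (λ s → sym (x≈ s))))
  where
  x≈ : x ≈ₚ (x fzero ◃ (x ∘ fsuc))
  x≈ fzero    = refl
  x≈ (fsuc s) = refl
  ◃-cong : ∀ {i} {y z : Pt (g ∘ fsuc)} → y ≈ₚ z → _◃_ {g = g} i y ≈ₚ (i ◃ z)
  ◃-cong y≈z fzero    = refl
  ◃-cong y≈z (fsuc s) = y≈z s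
  slice-sums : ∀ i → ∑ₚ (g ∘ fsuc) (λ y → f (i ◃ y)) ≡ ∑ₚ (g ∘ fsuc) (λ y → h (i ◃ y))
  slice-sums = ∑-mono-≤-≡⇒≡ (λ i → ∑ₚ-mono-≤ (g ∘ fsuc) (λ y → f≤h (i ◃ y))) eq
  on-slice : ∀ y → f (x fzero ◃ y) ≡ h (x fzero ◃ y)
  on-slice = ∑ₚ-mono-≤-≡⇒≡ (g ∘ fsuc) (f-resp ∘ ◃-cong) (h-resp ∘ ◃-cong)
               (λ y → f≤h (x fzero ◃ y)) (slice-sums (x fzero))

∑ₚ-prod : ∀ {m} (g : Fin m → ℕ) (h : (s : Fin m) → Fin (g s) → ℕ) →
          ∑ₚ g (λ x → prod (λ s → h s (x s))) ≡ prod (λ s → ∑[ i < g s ] h s i)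
∑ₚ-prod {zero}  g h = refl
∑ₚ-prod {suc m} g h = begin
  ∑[ i < g fzero ] ∑ₚ g′ (λ x → h fzero i * prod (λ s → h (fsuc s) (x s)))
    ≡⟨ sum-cong-≗ (λ i → ∑ₚ-*ˡ g′ (h fzero i) _) ⟩
  ∑[ i < g fzero ] (h fzero i * ∑ₚ g′ (λ x → prod (λ s → h (fsuc s) (x s))))
    ≡⟨ sum-cong-≗ (λ i → cong (h fzero i *_) (∑ₚ-prod g′ (h ∘ fsuc))) ⟩
  ∑[ i < g fzero ] (h fzero i * prod (λ s → ∑[ i < g′ s ] h (fsuc s) i))
    ≡⟨ sym (*-distribʳ-sum _ (h fzero)) ⟩
  (∑[ i < g fzero ] h fzero i) * prod (λ s → ∑[ i < g′ s ] h (fsuc s) i)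
    ∎
  where
  open ≡-Reasoning
  g′ : Fin m → ℕ
  g′ = g ∘ fsuc

Cuboid : ∀ {m} → (Fin m → ℕ) → Set
Cuboid {m} g = (s : Fin m) → Subset (g s)

_∈ᶜ_ : ∀ {m} {g : Fin m → ℕ} → Pt g → Cuboid g → Set
x ∈ᶜ A = ∀ s → x s ∈ₛ A s

Disjointᶜ : ∀ {m} {g : Fin m → ℕ} → Cuboid g → Cuboid g → Set
Disjointᶜ {g = g} A B = ¬ (Σ (Pt g) λ x → x ∈ᶜ A × x ∈ᶜ B)

whole : ∀ {m} (g : Fin m → ℕ) → Cuboid g
whole g s = ⊤

volume : ∀ {m} {g : Fin m → ℕ} → Cuboid g → ℕ
volume A = prod (λ s → ∣ A s ∣)

∣p∣≢0⇒Nonempty : ∀ {n} {p : Subset n} → ∣ p ∣ ≢ 0 → Nonempty p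
∣p∣≢0⇒Nonempty {n} {p} ∣p∣≢0 with nonempty? p
... | yes p≢∅ = p≢∅
... | no  p≡∅ = contradiction (trans (cong ∣_∣ (Empty-unique p≡∅)) (∣⊥∣≡0 n)) ∣p∣≢0

nonempty-cuboid : ∀ {m} {g : Fin m → ℕ} (A : Cuboid g) → (∀ s → ∣ A s ∣ ≢ 0) → ∃ λ x → x ∈ᶜ A
nonempty-cuboid A ∣A∣≢0 = (λ s → proj₁ (∣p∣≢0⇒Nonempty (∣A∣≢0 s))) ,
                          (λ s → proj₂ (∣p∣≢0⇒Nonempty (∣A∣≢0 s)))

Bool→ℕ : Bool → ℕ
Bool→ℕ true  = 1
Bool→ℕ false = 0

∑-membership≡∣p∣ : ∀ {n} (p : Subset n) → ∑[ i < n ] Bool→ℕ (lookup p i) ≡ ∣ p ∣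
∑-membership≡∣p∣ Vec.[]          = refl
∑-membership≡∣p∣ (true Vec.∷ p)  = cong suc (∑-membership≡∣p∣ p)
∑-membership≡∣p∣ (false Vec.∷ p) = ∑-membership≡∣p∣ p

indicator : ∀ {m} {g : Fin m → ℕ} → Cuboid g → Pt g → ℕ
indicator A x = prod (λ s → Bool→ℕ (lookup (A s) (x s)))

indicator-resp : ∀ {m} {g : Fin m → ℕ} (A : Cuboid g) → indicator A Preserves _≈ₚ_ ⟶ _≡_
indicator-resp A x≈y = prod-cong-≗ (λ s → cong (Bool→ℕ ∘ lookup (A s)) (x≈y s))

∈ᶜ⇒indicator≡1 : ∀ {m} {g : Fin m → ℕ} {A : Cuboid g} {x} → x ∈ᶜ A → indicator A x ≡ 1
∈ᶜ⇒indicator≡1 {m} x∈A =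
  trans (prod-cong-≗ (λ s → cong Bool→ℕ ([]=⇒lookup (x∈A s)))) (prod-replicate-one m)

indicator≡0⊎∈ᶜ : ∀ {m} {g : Fin m → ℕ} (A : Cuboid g) x → indicator A x ≡ 0 ⊎ x ∈ᶜ A
indicator≡0⊎∈ᶜ {zero}  A x = inj₂ (λ ())
indicator≡0⊎∈ᶜ {suc m} A x with lookup (A fzero) (x fzero) in x₀∈?A₀
... | false = inj₁ refl
... | true with indicator≡0⊎∈ᶜ (A ∘ fsuc) (x ∘ fsuc)
...   | inj₁ tail≡0 = inj₁ (trans (+-identityʳ _) tail≡0)
...   | inj₂ x′∈A′  = inj₂ λ { fzero → lookup⇒[]= (x fzero) (A fzero) x₀∈?A₀ ; (fsuc s) → x′∈A′ s }

volume≡∑ₚindicator : ∀ {m} (g : Fin m → ℕ) (A : Cuboid g) → ∑ₚ g (indicator A) ≡ volume A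
volume≡∑ₚindicator g A =
  trans (∑ₚ-prod g (λ s i → Bool→ℕ (lookup (A s) i))) (prod-cong-≗ (∑-membership≡∣p∣ ∘ A))

volume-whole : ∀ {m} (g : Fin m → ℕ) → volume (whole g) ≡ prod g
volume-whole g = prod-cong-≗ (λ s → ∣⊤∣≡n (g s))

multiplicity : ∀ {m} {g : Fin m → ℕ} → List (Cuboid g) → Pt g → ℕ
multiplicity χ x = sum (map (λ A → indicator A x) χ)

multiplicity-resp : ∀ {m} {g : Fin m → ℕ} (χ : List (Cuboid g)) →
                    multiplicity χ Preserves _≈ₚ_ ⟶ _≡_
multiplicity-resp []      x≈y = refl
multiplicity-resp (A ∷ χ) x≈y = cong₂ _+_ (indicator-resp A x≈y) (multiplicity-resp χ x≈y)

∑ₚ-multiplicity : ∀ {m} (g : Fin m → ℕ) (χ : List (Cuboid g)) →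
                  ∑ₚ g (multiplicity χ) ≡ sum (map volume χ)
∑ₚ-multiplicity g []      = ∑ₚ-zero g
∑ₚ-multiplicity g (A ∷ χ) =
  trans (∑ₚ-distrib-+ g (indicator A) (multiplicity χ))
        (cong₂ _+_ (volume≡∑ₚindicator g A) (∑ₚ-multiplicity g χ))

multiplicity≢0⇒Any : ∀ {m} {g : Fin m → ℕ} (χ : List (Cuboid g)) x →
                     multiplicity χ x ≢ 0 → Any (x ∈ᶜ_) χ
multiplicity≢0⇒Any []      x μ≢0 = contradiction refl μ≢0
multiplicity≢0⇒Any (A ∷ χ) x μ≢0 with indicator≡0⊎∈ᶜ A x
... | inj₁ x∉A = there (multiplicity≢0⇒Any χ x λ μ≡0 → μ≢0 (cong₂ _+_ x∉A μ≡0))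
... | inj₂ x∈A = here x∈A

All∉⇒multiplicity≡0 : ∀ {m} {g : Fin m → ℕ} (χ : List (Cuboid g)) x →
                      All (λ A → ¬ x ∈ᶜ A) χ → multiplicity χ x ≡ 0
All∉⇒multiplicity≡0 χ x x∉χ with multiplicity χ x ≟ 0
... | yes μ≡0 = μ≡0
... | no  μ≢0 = contradiction (multiplicity≢0⇒Any χ x μ≢0) (All¬⇒¬Any x∉χ)

multiplicity≤1 : ∀ {m} {g : Fin m → ℕ} {χ : List (Cuboid g)} →
                 AllPairs Disjointᶜ χ → ∀ x → multiplicity χ x ≤ 1
multiplicity≤1 [] x = z≤n
multiplicity≤1 {χ = A ∷ χ} (A#χ ∷ pairwise) x with indicator≡0⊎∈ᶜ A x
... | inj₁ x∉A rewrite x∉A = multiplicity≤1 pairwise x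
... | inj₂ x∈A rewrite ∈ᶜ⇒indicator≡1 x∈A
                     | All∉⇒multiplicity≡0 χ x (All.map (λ A#B x∈B → A#B (x , x∈A , x∈B)) A#χ)
                     = s≤s z≤n

disjoint-full-volume⇒covering : ∀ {m} (g : Fin m → ℕ) (χ : List (Cuboid g)) →
                                AllPairs Disjointᶜ χ → sum (map volume χ) ≡ prod g →
                                ∀ x → Any (x ∈ᶜ_) χ
disjoint-full-volume⇒covering g χ pairwise volumes x =
  multiplicity≢0⇒Any χ x λ μ≡0 → contradiction (trans (sym μ≡0) (μ≡1 x)) λ ()
  where
  everywhere-1 : ∀ x → indicator (whole g) x ≡ 1
  everywhere-1 x = ∈ᶜ⇒indicator≡1 {A = whole g} (λ s → ∈⊤)
  μ≤whole : ∀ x → multiplicity χ x ≤ indicator (whole g) x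
  μ≤whole x = ≤-trans (multiplicity≤1 pairwise x) (≤-reflexive (sym (everywhere-1 x)))
  total : ∑ₚ g (multiplicity χ) ≡ ∑ₚ g (indicator (whole g))
  total = trans (∑ₚ-multiplicity g χ)
                (trans volumes (sym (trans (volume≡∑ₚindicator g (whole g)) (volume-whole g))))
  μ≡1 : ∀ x → multiplicity χ x ≡ 1
  μ≡1 x = trans (∑ₚ-mono-≤-≡⇒≡ g (multiplicity-resp χ) (indicator-resp (whole g)) μ≤whole total x)
                (everywhere-1 x)

F!-+ : ∀ (F : ℕ → ℕ) j m → (F F!) (j + m) ≡ prod {m} (λ s → F (suc j + toℕ s)) * (F F!) j
F!-+ F j zero    = trans (cong (F F!) (+-identityʳ j)) (sym (+-identityʳ _))
F!-+ F j (suc m) = begin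
  (F F!) (j + suc m)                          ≡⟨ cong (F F!) (+-suc j m) ⟩
  (F F!) (suc j + m)                          ≡⟨ F!-+ F (suc j) m ⟩
  P * (F (suc j) * (F F!) j)                  ≡⟨ sym (*-assoc P _ _) ⟩
  P * F (suc j) * (F F!) j                    ≡⟨ cong (_* (F F!) j) (*-comm P _) ⟩
  F (suc j) * P * (F F!) j                    ≡⟨ cong₂ (λ a b → F a * b * (F F!) j)
                                                       (sym (+-identityʳ (suc j)))
                                                       (prod-cong-≗ {m} (λ s → cong F (sym (+-suc (suc j) (toℕ s))))) ⟩
  prod {suc m} (λ s → F (suc j + toℕ s)) * (F F!) j ∎
  where
  open ≡-Reasoning
  P : ℕ
  P = prod {m} (λ s → F (suc (suc j) + toℕ s))

F!≢0 : ∀ (F : ℕ → ℕ) → (∀ i → F (suc i) ≢ 0) → ∀ j → (F F!) j ≢ 0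
F!≢0 F F≢0 zero    ()
F!≢0 F F≢0 (suc j) F!≡0 with m*n≡0⇒m≡0∨n≡0 (F (suc j)) F!≡0
... | inj₁ F≡0  = F≢0 j F≡0
... | inj₂ F!≡0 = F!≢0 F F≢0 j F!≡0

σ-box-volume : ∀ (F : ℕ → ℕ) k m (A : Box F k m) → IsSigmaBox F k m A → volume A ≡ (F F!) m
σ-box-volume F k m A (σ , ∣A∣) = begin
  prod {m} (λ s → ∣ A s ∣)                    ≡⟨ prod-cong-≗ ∣A∣ ⟩
  prod {m} (λ s → F (suc (toℕ (σ ⟨$⟩ʳ s))))  ≡⟨ sym (prod-permute (λ s → F (suc (toℕ s))) σ) ⟩
  prod {m} (λ s → F (suc (toℕ s)))            ≡⟨ sym (*-identityʳ _) ⟩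
  prod {m} (λ s → F (suc (toℕ s))) * 1        ≡⟨ sym (F!-+ F 0 m) ⟩
  (F F!) m                                    ∎
  where open ≡-Reasoning

grid-size : ∀ (F : ℕ → ℕ) → (∀ i → F (suc i) ≢ 0) → ∀ j n d → suc j ≤ n →
            let m = suc (n ∸ suc j) in
            d * ((F F!) m * (F F!) (n ∸ m)) ≡ (F F!) n →
            d * (F F!) m ≡ prod {m} (λ s → F (suc j + toℕ s))
grid-size F F≢0 j n d k≤n eq =
  *-cancelʳ-≡ _ _ ((F F!) j) {{≢-nonZero (F!≢0 F F≢0 j)}} (begin
    d * (F F!) m * (F F!) j                    ≡⟨ *-assoc d _ _ ⟩
    d * ((F F!) m * (F F!) j)                  ≡⟨ cong (λ i → d * ((F F!) m * (F F!) i)) (sym n∸m≡j) ⟩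
    d * ((F F!) m * (F F!) (n ∸ m))            ≡⟨ eq ⟩
    (F F!) n                                   ≡⟨ cong (F F!) n≡j+m ⟩
    (F F!) (j + m)                             ≡⟨ F!-+ F j m ⟩
    prod {m} (λ s → F (suc j + toℕ s)) * (F F!) j ∎)
  where
  open ≡-Reasoning
  m : ℕ
  m = suc (n ∸ suc j)
  n≡j+m : n ≡ j + m
  n≡j+m = sym (trans (+-suc j (n ∸ suc j)) (m+[n∸m]≡n k≤n))
  n∸m≡j : n ∸ m ≡ j
  n∸m≡j = trans (cong (_∸ m) n≡j+m) (m+n∸n≡m j m)

sum-map-const : ∀ {A : Set} (f : A → ℕ) c (xs : List A) → All (λ a → f a ≡ c) xs →
                sum (map f xs) ≡ length xs * c
sum-map-const f c []       []           = refl
sum-map-const f c (x ∷ xs) (fx≡c ∷ all) = cong₂ _+_ fx≡c (sum-map-const f c xs all)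

mainTheorem10 : (F : ℕ → ℕ) → Admissible F → (k n m d : ℕ) → 1 ≤ k → k ≤ n →
    m ≡ suc (n ∸ k) →
    d * ((F F!) m * (F F!) (n ∸ m)) ≡ (F F!) n →
    (χ : List (Box F k m)) → IsClique F k m χ → length χ ≡ d →
    IsMaximalClique F k m χ
mainTheorem10 F (F≢0 , _) (suc j) n .(suc (n ∸ suc j)) .(length χ) _ k≤n refl eq χ clique@(σ-boxes , pairwise) refl =
  clique , λ B σB B#χ →
    let x , x∈B = nonempty-cuboid B (λ s ∣Bs∣≡0 → F≢0 _ (trans (sym (proj₂ σB s)) ∣Bs∣≡0))
    in contradiction (covered x) (All¬⇒¬Any (All.map (λ B#A x∈A → B#A (x , x∈B , x∈A)) B#χ))
  where
  open ≡-Reasoning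
  m : ℕ
  m = suc (n ∸ suc j)
  volumes : sum (map volume χ) ≡ prod {m} (λ s → F (suc j + toℕ s))
  volumes = begin
    sum (map volume χ)                  ≡⟨ sum-map-const volume _ χ (All.map (λ {A} → σ-box-volume F (suc j) m A) σ-boxes) ⟩
    length χ * (F F!) m                 ≡⟨ grid-size F F≢0 j n (length χ) k≤n eq ⟩
    prod {m} (λ s → F (suc j + toℕ s)) ∎
  covered : ∀ x → Any (x ∈ᶜ_) χ
  covered = disjoint-full-volume⇒covering _ χ pairwise volumes
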